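{- For every integer $n\geq 2$, $$ B_{n+1}'(0)=\frac{(-1)^n}{(n-1)(n-1)!}. $$
   Context: The polynomials $B_n\in\mathbb{Q}[s]$ are defined by $B_1=0$ and, for $n\geq 1$, $B_{n+1}$ is the unique polynomial with $B_{n+1}(1)=0$ and $B_{n+1}'(s)=B_n(s)-\frac{s^{n-1}}{n!}$. -}

module Defs where

open import Data.Nat as ℕ using (ℕ; zero; suc; _!)
open import Data.Nat.Properties using (_!≢0)
open import Data.Integer as ℤ using (+_)
open import Data.List using (List; []; _∷_)
open import Data.Rational using (ℚ; 0ℚ; 1ℚ; _+_; _*_; -_; _/_)

-- Polynomials in ℚ[s] as coefficient lists, lowest degree first:
-- a₀ ∷ a₁ ∷ … represents a₀ + a₁ s + a₂ s² + …
Poly : Set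
Poly = List ℚ

eval : Poly → ℚ → ℚ
eval []       x = 0ℚ
eval (a ∷ p) x = a + x * eval p x

derivAux : ℕ → Poly → Poly
derivAux k []      = []
derivAux k (a ∷ p) = ((+ k / 1) * a) ∷ derivAux (suc k) p

deriv : Poly → Poly
deriv []      = []
deriv (a ∷ p) = derivAux 1 p

_⊕_ : Poly → Poly → Poly
[]      ⊕ q       = q
(a ∷ p) ⊕ []      = a ∷ p
(a ∷ p) ⊕ (b ∷ q) = (a + b) ∷ (p ⊕ q)

⊖_ : Poly → Poly
⊖ []      = []
⊖ (a ∷ p) = (- a) ∷ (⊖ p)

monomial : ℕ → ℚ → Poly
monomial zero    c = c ∷ []
monomial (suc k) c = 0ℚ ∷ monomial k c

integAux : ℕ → Poly → Poly
integAux k []      = []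
integAux k (a ∷ p) = ((+ 1 / suc k) * a) ∷ integAux (suc k) p

integ : Poly → Poly
integ p = 0ℚ ∷ integAux 0 p

integ₁ : Poly → Poly
integ₁ p = integ p ⊕ ((- eval (integ p) 1ℚ) ∷ [])

invFact : ℕ → ℚ
invFact n = + 1 / (n !) where instance _ = n !≢0

-- Bsuc k = B_{k+1}.  B₁ = 0, and for n = k+1 ≥ 1,
-- B_{n+1} = the polynomial with B_{n+1}(1) = 0 and B_{n+1}' = B_n - s^{n-1}/n!.
Bsuc : ℕ → Poly
Bsuc zero    = []
Bsuc (suc k) = integ₁ (Bsuc k ⊕ (⊖ monomial k (invFact (suc k))))

-- B n for n ≥ 1 (B 0 is an unused dummy value)
B : ℕ → Poly
B zero    = []
B (suc k) = Bsuc k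

signℚ : ℕ → ℚ
signℚ zero    = 1ℚ
signℚ (suc n) = - signℚ n

-- 1/m in ℚ for m ≥ 1 (only used with m ≥ 1; 1/0 is set to 0)
invℕ : ℕ → ℚ
invℕ zero    = 0ℚ
invℕ (suc m) = + 1 / suc m

{-# OPTIONS --safe #-}
-- For n ≥ 2 the monomial s^{n-1}/n! has no constant term, so B_{n+1}'(0) = B_n(0).
-- Since B_n(1) = 0, B_n(0) = -∫₀¹ B_n' = 1/((n-1)(n-1)!) - ∫₀¹ B_{n-1}.  The moments
-- ∫₀¹ sʲ B_{p+1}(s) ds are computed in closed form by induction on p: integrating by parts against
-- B_{p+2}(1) = 0 gives (j+1) ∫₀¹ sʲ B_{p+2} = 1/((p+j+2)(p+1)!) - ∫₀¹ s^{j+1} B_{p+1}, and the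
-- remaining work is partial fractions.
module Submission where

open import Defs
open import Data.Nat using (ℕ; suc; _≤_; _∸_; _*_; _!)
open import Data.Rational using (ℚ; 0ℚ) renaming (_*_ to _*ℚ_)
open import Relation.Binary.PropositionalEquality using (_≡_)

open import Level using (0ℓ)
open import Data.Nat as ℕ using (zero; NonZero; pred; s≤s)
open import Data.Nat.Properties as ℕ using (_!≢0; m*n≢0; +-suc)
open import Data.Integer as ℤ using (+_)
import Data.Integer.Properties as ℤ
open import Data.List using ([]; _∷_)
open import Data.Rational using (1ℚ; _+_; -_; _-_; _/_; toℚᵘ) renaming (_*_ to _·_)
open import Data.Rational.Properties
  using (_≟_; +-*-commutativeRing; +-0-commutativeMonoid; toℚᵘ-injective; toℚᵘ-fromℚᵘ
        ; toℚᵘ-homo-+; toℚᵘ-homo-*; /-cong; +-identityˡ; +-identityʳ; +-inverseʳ; *-identityˡ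
        ; *-zeroˡ; *-zeroʳ; *-assoc; *-distribˡ-+; neg-distrib-+; neg-distribʳ-*)
open import Algebra.Bundles using (CommutativeMonoid)
open import Algebra.Properties.CommutativeSemigroup (CommutativeMonoid.commutativeSemigroup +-0-commutativeMonoid)
  using (interchange)
open import Data.Rational.Unnormalised as ℚᵘ using (mkℚᵘ; *≡*) renaming (_≃_ to _≃ᵘ_)
import Data.Rational.Unnormalised.Properties as ℚᵘ
open import Relation.Binary.PropositionalEquality using (refl; sym; trans; cong; cong₂; module ≡-Reasoning)
open import Relation.Nullary.Decidable using (dec⇒maybe)
open import Tactic.RingSolver using (solve)
open import Tactic.RingSolver.Core.AlmostCommutativeRing using (AlmostCommutativeRing; fromCommutativeRing)

ℚ-ring : AlmostCommutativeRing 0ℓ 0ℓ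
ℚ-ring = fromCommutativeRing +-*-commutativeRing (λ x → dec⇒maybe (0ℚ ≟ x))

-- lhs ≡ rhs follows from hypotheses xᵢ ≡ yᵢ as soon as lhs ≡ rhs + Σ cᵢ · (xᵢ - yᵢ) is a ring
-- identity, which `solve` then checks.

infix  7 _∙_
infixr 6 _⊞_

_∙_ : ∀ c {x y} → x ≡ y → c · (x - y) ≡ 0ℚ
_∙_ c {x} refl = trans (cong (c ·_) (+-inverseʳ x)) (*-zeroʳ c)

_⊞_ : ∀ {a b} → a ≡ 0ℚ → b ≡ 0ℚ → a + b ≡ 0ℚ
refl ⊞ refl = +-identityʳ 0ℚ

linear-combination : ∀ {lhs rhs e} → e ≡ 0ℚ → lhs ≡ rhs + e → lhs ≡ rhs
linear-combination {rhs = rhs} refl eq = trans eq (+-identityʳ rhs)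

inverse-difference : ∀ r₁ r₂ n d → n · r₁ ≡ 1ℚ → (n + d) · r₂ ≡ 1ℚ → r₁ - r₂ ≡ d · r₁ · r₂
inverse-difference r₁ r₂ n d h₁ h₂ =
  linear-combination (r₂ ∙ h₁ ⊞ (- r₁) ∙ h₂) (solve (r₁ ∷ r₂ ∷ n ∷ d ∷ []) ℚ-ring)

ι : ℕ → ℚ
ι n = + n / 1

toℚᵘ-/ : ∀ i n .{{_ : NonZero n}} → toℚᵘ (i / n) ≃ᵘ mkℚᵘ i (pred n)
toℚᵘ-/ i (suc n) = toℚᵘ-fromℚᵘ (mkℚᵘ i n)

/1-+ : ∀ i j → (i ℤ.+ j) / 1 ≡ i / 1 + j / 1
/1-+ i j = toℚᵘ-injective (ℚᵘ.≃-trans (toℚᵘ-/ (i ℤ.+ j) 1) (ℚᵘ.≃-sym (ℚᵘ.≃-trans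
  (toℚᵘ-homo-+ (i / 1) (j / 1))
  (ℚᵘ.≃-trans (ℚᵘ.+-cong (toℚᵘ-/ i 1) (toℚᵘ-/ j 1))
    (ℚᵘ.≃-reflexive (cong (λ k → mkℚᵘ k 0) (cong₂ ℤ._+_ (ℤ.*-identityʳ i) (ℤ.*-identityʳ j))))))))

/-* : ∀ i j m n .{{_ : NonZero m}} .{{_ : NonZero n}} →
      ((i ℤ.* j) / (m ℕ.* n)) {{m*n≢0 m n}} ≡ (i / m) · (j / n)
/-* i j (suc m) (suc n) = toℚᵘ-injective (ℚᵘ.≃-trans (toℚᵘ-/ (i ℤ.* j) (suc m ℕ.* suc n))
  (ℚᵘ.≃-sym (ℚᵘ.≃-trans (toℚᵘ-homo-* (i / suc m) (j / suc n))
    (ℚᵘ.*-cong (toℚᵘ-/ i (suc m)) (toℚᵘ-/ j (suc n))))))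

n/n≡1 : ∀ n .{{_ : NonZero n}} → + n / n ≡ 1ℚ
n/n≡1 (suc n) = toℚᵘ-injective (ℚᵘ.≃-trans (toℚᵘ-/ (+ suc n) (suc n)) (*≡* (ℤ.*-comm (+ suc n) (+ 1))))

ι-+ : ∀ m n → ι (m ℕ.+ n) ≡ ι m + ι n
ι-+ m n = trans (cong (_/ 1) (ℤ.pos-+ m n)) (/1-+ (+ m) (+ n))

ι-* : ∀ m n → ι (m ℕ.* n) ≡ ι m · ι n
ι-* m n = trans (cong (_/ 1) (ℤ.pos-* m n)) (/-* (+ m) (+ n) 1 1)

ι[n]·1/n≡1 : ∀ n .{{_ : NonZero n}} → ι n · (+ 1 / n) ≡ 1ℚ
ι[n]·1/n≡1 n = trans (sym (/-* (+ n) (+ 1) 1 n))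
  (trans (/-cong {{m*n≢0 1 n}} (ℤ.*-identityʳ (+ n)) (ℕ.*-identityˡ n)) (n/n≡1 n))

1/-* : ∀ m n .{{_ : NonZero m}} .{{_ : NonZero n}} →
       (+ 1 / (m ℕ.* n)) {{m*n≢0 m n}} ≡ (+ 1 / m) · (+ 1 / n)
1/-* m n = /-* (+ 1) (+ 1) m n

invℕ≡1/ : ∀ n .{{_ : NonZero n}} → invℕ n ≡ + 1 / n
invℕ≡1/ (suc n) = refl

ι[n!]·invFact≡1 : ∀ n → ι (n !) · invFact n ≡ 1ℚ
ι[n!]·invFact≡1 n = ι[n]·1/n≡1 (n !) {{n !≢0}}

invFact-suc : ∀ n → invFact (suc n) ≡ invℕ (suc n) · invFact n
invFact-suc n = 1/-* (suc n) (n !) {{_}} {{n !≢0}}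

invℕ-*-! : ∀ m n → invℕ (suc m * n !) ≡ invℕ (suc m) · invFact n
invℕ-*-! m n = trans (invℕ≡1/ (suc m * n !) {{m*n≢0 (suc m) (n !) {{_}} {{n !≢0}}}})
                     (1/-* (suc m) (n !) {{_}} {{n !≢0}})

⊕-identityʳ : ∀ p → p ⊕ [] ≡ p
⊕-identityʳ []      = refl
⊕-identityʳ (a ∷ p) = refl

eval-⊕ : ∀ p q x → eval (p ⊕ q) x ≡ eval p x + eval q x
eval-⊕ []      q       x = sym (+-identityˡ (eval q x))
eval-⊕ (a ∷ p) []      x = sym (+-identityʳ (eval (a ∷ p) x))
eval-⊕ (a ∷ p) (b ∷ q) x = begin
  (a + b) + x · eval (p ⊕ q) x              ≡⟨ cong (λ e → (a + b) + x · e) (eval-⊕ p q x) ⟩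
  (a + b) + x · (eval p x + eval q x)       ≡⟨ cong (_+_ (a + b)) (*-distribˡ-+ x (eval p x) (eval q x)) ⟩
  (a + b) + (x · eval p x + x · eval q x)   ≡⟨ interchange a b (x · eval p x) (x · eval q x) ⟩
  (a + x · eval p x) + (b + x · eval q x)   ∎
  where open ≡-Reasoning

eval-⊖ : ∀ p x → eval (⊖ p) x ≡ - eval p x
eval-⊖ []      x = refl
eval-⊖ (a ∷ p) x = begin
  - a + x · eval (⊖ p) x   ≡⟨ cong (λ e → - a + x · e) (eval-⊖ p x) ⟩
  - a + x · - eval p x     ≡⟨ cong (_+_ (- a)) (neg-distribʳ-* x (eval p x)) ⟨
  - a + - (x · eval p x)   ≡⟨ neg-distrib-+ a (x · eval p x) ⟨
  - (a + x · eval p x)     ∎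
  where open ≡-Reasoning

eval-at-0 : ∀ a p → eval (a ∷ p) 0ℚ ≡ a
eval-at-0 a p = trans (cong (_+_ a) (*-zeroˡ (eval p 0ℚ))) (+-identityʳ a)

derivAux-integAux : ∀ k p → derivAux (suc k) (integAux k p) ≡ p
derivAux-integAux k []      = refl
derivAux-integAux k (a ∷ p) = cong₂ _∷_ ι[n]·1/n≡1·a (derivAux-integAux (suc k) p)
  where
  ι[n]·1/n≡1·a : ι (suc k) · (invℕ (suc k) · a) ≡ a
  ι[n]·1/n≡1·a = trans (sym (*-assoc (ι (suc k)) (invℕ (suc k)) a))
                 (trans (cong (_· a) (ι[n]·1/n≡1 (suc k))) (*-identityˡ a))

deriv-integ₁ : ∀ p → deriv (integ₁ p) ≡ p
deriv-integ₁ p = trans (cong (derivAux 1) (⊕-identityʳ (integAux 0 p))) (derivAux-integAux 0 p)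

-- moment j p = ∫₀¹ sʲ p(s) ds
moment : ℕ → Poly → ℚ
moment j []      = 0ℚ
moment j (a ∷ p) = invℕ (suc j) · a + moment (suc j) p

moment-⊕ : ∀ j p q → moment j (p ⊕ q) ≡ moment j p + moment j q
moment-⊕ j []      q       = sym (+-identityˡ (moment j q))
moment-⊕ j (a ∷ p) []      = sym (+-identityʳ (moment j (a ∷ p)))
moment-⊕ j (a ∷ p) (b ∷ q) = begin
  r · (a + b) + moment (suc j) (p ⊕ q)   ≡⟨ cong₂ _+_ (*-distribˡ-+ r a b) (moment-⊕ (suc j) p q) ⟩
  (r · a + r · b) + (P + Q)              ≡⟨ interchange (r · a) (r · b) P Q ⟩
  (r · a + P) + (r · b + Q)              ∎
  where
  open ≡-Reasoning
  r = invℕ (suc j)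
  P = moment (suc j) p
  Q = moment (suc j) q

moment-⊖ : ∀ j p → moment j (⊖ p) ≡ - moment j p
moment-⊖ j []      = refl
moment-⊖ j (a ∷ p) = begin
  r · - a + moment (suc j) (⊖ p)   ≡⟨ cong₂ _+_ (sym (neg-distribʳ-* r a)) (moment-⊖ (suc j) p) ⟩
  - (r · a) + - P                  ≡⟨ neg-distrib-+ (r · a) P ⟨
  - (r · a + P)                    ∎
  where
  open ≡-Reasoning
  r = invℕ (suc j)
  P = moment (suc j) p

moment-monomial : ∀ k j c → moment j (monomial k c) ≡ invℕ (suc (k ℕ.+ j)) · c
moment-monomial zero    j c = +-identityʳ (invℕ (suc j) · c)
moment-monomial (suc k) j c = begin
  invℕ (suc j) · 0ℚ + moment (suc j) (monomial k c)   ≡⟨ cong₂ _+_ (*-zeroʳ (invℕ (suc j))) (moment-monomial k (suc j) c) ⟩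
  0ℚ + invℕ (suc (k ℕ.+ suc j)) · c                    ≡⟨ +-identityˡ _ ⟩
  invℕ (suc (k ℕ.+ suc j)) · c                         ≡⟨ cong (λ N → invℕ (suc N) · c) (+-suc k j) ⟩
  invℕ (suc (suc k ℕ.+ j)) · c                         ∎
  where open ≡-Reasoning

eval-integAux-1 : ∀ k p → eval (integAux k p) 1ℚ ≡ moment k p
eval-integAux-1 k []      = refl
eval-integAux-1 k (a ∷ p) =
  cong (_+_ (invℕ (suc k) · a)) (trans (*-identityˡ _) (eval-integAux-1 (suc k) p))

eval-integ₁-0 : ∀ p → eval (integ₁ p) 0ℚ ≡ - moment 0 p
eval-integ₁-0 p = begin
  eval (integ₁ p) 0ℚ                        ≡⟨ eval-at-0 _ (integAux 0 p ⊕ []) ⟩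
  0ℚ + - (0ℚ + 1ℚ · eval (integAux 0 p) 1ℚ)  ≡⟨ +-identityˡ _ ⟩
  - (0ℚ + 1ℚ · eval (integAux 0 p) 1ℚ)       ≡⟨ cong -_ (trans (+-identityˡ _) (*-identityˡ _)) ⟩
  - eval (integAux 0 p) 1ℚ                   ≡⟨ cong -_ (eval-integAux-1 0 p) ⟩
  - moment 0 p                               ∎
  where open ≡-Reasoning

eval-0-⊖-monomial : ∀ p k c → eval (p ⊕ (⊖ monomial (suc k) c)) 0ℚ ≡ eval p 0ℚ
eval-0-⊖-monomial p k c = begin
  eval (p ⊕ (⊖ monomial (suc k) c)) 0ℚ               ≡⟨ eval-⊕ p (⊖ monomial (suc k) c) 0ℚ ⟩
  eval p 0ℚ + eval (⊖ monomial (suc k) c) 0ℚ        ≡⟨ cong (_+_ (eval p 0ℚ)) (eval-⊖ (monomial (suc k) c) 0ℚ) ⟩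
  eval p 0ℚ + - eval (monomial (suc k) c) 0ℚ        ≡⟨ cong (λ e → eval p 0ℚ + - e) (eval-at-0 0ℚ (monomial k c)) ⟩
  eval p 0ℚ + - 0ℚ                                  ≡⟨ +-identityʳ (eval p 0ℚ) ⟩
  eval p 0ℚ                                         ∎
  where open ≡-Reasoning

moment-integAux : ∀ k d q →
  ι (suc d) · moment (k ℕ.+ suc d) (integAux k q) ≡ moment k q - moment (k ℕ.+ suc d) q
moment-integAux k d []      = trans (*-zeroʳ (ι (suc d))) (sym (+-inverseʳ 0ℚ))
moment-integAux k d (a ∷ q) = step (ι (suc d)) rₘ rₖ X (moment (suc k) q) (moment (suc m) q)
  (inverse-difference rₖ rₘ (ι (suc k)) (ι (suc d)) (ι[n]·1/n≡1 (suc k)) ι[1+m]·rₘ≡1)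
  (moment-integAux (suc k) d q)
  where
  m = k ℕ.+ suc d
  rₖ = invℕ (suc k)
  rₘ = invℕ (suc m)
  X = moment (suc m) (integAux (suc k) q)
  ι[1+m]·rₘ≡1 : (ι (suc k) + ι (suc d)) · rₘ ≡ 1ℚ
  ι[1+m]·rₘ≡1 = trans (cong (_· rₘ) (sym (ι-+ (suc k) (suc d)))) (ι[n]·1/n≡1 (suc m))
  step : ∀ D rₘ rₖ X Y Z → rₖ - rₘ ≡ D · rₖ · rₘ → D · X ≡ Y - Z →
         D · (rₘ · (rₖ · a) + X) ≡ (rₖ · a + Y) - (rₘ · a + Z)
  step D rₘ rₖ X Y Z h₁ h₂ =
    linear-combination ((- a) ∙ h₁ ⊞ 1ℚ ∙ h₂) (solve (D ∷ rₘ ∷ rₖ ∷ X ∷ Y ∷ Z ∷ a ∷ []) ℚ-ring)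

moment-integ₁ : ∀ j p → moment j (integ₁ p) ≡ - (invℕ (suc j) · moment (suc j) p)
moment-integ₁ j p = begin
  r · (0ℚ + - eval (integ p) 1ℚ) + moment (suc j) (integAux 0 p ⊕ [])
    ≡⟨ cong₂ (λ c X → r · c + X) (trans (sym (eval-at-0 _ (integAux 0 p ⊕ []))) (eval-integ₁-0 p))
                                (cong (moment (suc j)) (⊕-identityʳ (integAux 0 p))) ⟩
  r · - moment 0 p + moment (suc j) (integAux 0 p)
    ≡⟨ by-parts r (ι (suc j)) (moment 0 p) (moment (suc j) p) (moment (suc j) (integAux 0 p))
                (ι[n]·1/n≡1 (suc j)) (moment-integAux 0 j p) ⟩
  - (r · moment (suc j) p) ∎
  where
  open ≡-Reasoning
  r = invℕ (suc j)
  by-parts : ∀ r J M₀ M X → J · r ≡ 1ℚ → J · X ≡ M₀ - M → r · - M₀ + X ≡ - (r · M)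
  by-parts r J M₀ M X h₁ h₂ =
    linear-combination ((- X) ∙ h₁ ⊞ r ∙ h₂) (solve (r ∷ J ∷ M₀ ∷ M ∷ X ∷ []) ℚ-ring)

-- B′ p = B_{p+1} - s^p/(p+1)!, so that Bsuc (suc p) = integ₁ (B′ p) by definition.
B′ : ℕ → Poly
B′ p = Bsuc p ⊕ (⊖ monomial p (invFact (suc p)))

moment-B′ : ∀ p j → moment j (B′ p) ≡ moment j (Bsuc p) - invℕ (suc (p ℕ.+ j)) · invFact (suc p)
moment-B′ p j = begin
  moment j (B′ p)                                          ≡⟨ moment-⊕ j (Bsuc p) (⊖ monomial p F) ⟩
  moment j (Bsuc p) + moment j (⊖ monomial p F)            ≡⟨ cong (_+_ (moment j (Bsuc p))) (moment-⊖ j (monomial p F)) ⟩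
  moment j (Bsuc p) - moment j (monomial p F)              ≡⟨ cong (λ e → moment j (Bsuc p) - e) (moment-monomial p j F) ⟩
  moment j (Bsuc p) - invℕ (suc (p ℕ.+ j)) · F             ∎
  where
  open ≡-Reasoning
  F = invFact (suc p)

moment-B : ℕ → ℕ → ℚ
moment-B p j = signℚ (suc p) · ι (j !) · invℕ (suc (p ℕ.+ j)) · invFact (suc (p ℕ.+ j))
             + invℕ (suc (p ℕ.+ j)) · invℕ (suc (p ℕ.+ j)) · invFact p

moment-Bsuc : ∀ p j → moment j (Bsuc p) ≡ moment-B p j
moment-Bsuc zero    j = base (ι (j !)) (invℕ (suc j)) (invFact j) (invFact-suc j) (ι[n!]·invFact≡1 j)
  where
  base : ∀ x r b {f} → f ≡ r · b → x · b ≡ 1ℚ → 0ℚ ≡ (- 1ℚ) · x · r · f + r · r · 1ℚ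
  base x r b refl h = linear-combination ((r · r) ∙ h) (solve (x ∷ r ∷ b ∷ []) ℚ-ring)
moment-Bsuc (suc p) j = begin
  moment j (integ₁ (B′ p))                    ≡⟨ moment-integ₁ j (B′ p) ⟩
  - (r · moment (suc j) (B′ p))               ≡⟨ cong (λ M → - (r · M)) (moment-B′ p (suc j)) ⟩
  - (r · (moment (suc j) (Bsuc p) - u · a))   ≡⟨ cong (λ M → - (r · (M - u · a))) (moment-Bsuc p (suc j)) ⟩
  - (r · (moment-B p (suc j) - u · a))
    ≡⟨ recurrence s x u f b r (ι (suc j)) rₚ (ι-* (suc j) (j !)) (invFact-suc p) (ι[n]·1/n≡1 (suc j))
         (inverse-difference rₚ u (ι (suc p)) (ι (suc j)) (ι[n]·1/n≡1 (suc p)) ι[1+N]·u≡1) ⟩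
  (- s) · x · u · f + u · u · a
    ≡⟨ cong (λ N → (- s) · x · invℕ (suc N) · invFact (suc N) + invℕ (suc N) · invℕ (suc N) · a) (+-suc p j) ⟩
  moment-B (suc p) j ∎
  where
  open ≡-Reasoning
  N = p ℕ.+ suc j
  s = signℚ (suc p)
  x = ι (j !)
  r = invℕ (suc j)
  rₚ = invℕ (suc p)
  u = invℕ (suc N)
  f = invFact (suc N)
  a = invFact (suc p)
  b = invFact p
  ι[1+N]·u≡1 : (ι (suc p) + ι (suc j)) · u ≡ 1ℚ
  ι[1+N]·u≡1 = trans (cong (_· u) (sym (ι-+ (suc p) (suc j)))) (ι[n]·1/n≡1 (suc N))
  recurrence : ∀ s x u f b r J rₚ {Y a} → Y ≡ J · x → a ≡ rₚ · b → J · r ≡ 1ℚ → rₚ - u ≡ J · rₚ · u →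
               - (r · ((s · Y · u · f + u · u · b) - u · a)) ≡ (- s) · x · u · f + u · u · a
  recurrence s x u f b r J rₚ refl refl h₁ h₂ =
    linear-combination ((u · u · rₚ · b - s · x · u · f) ∙ h₁ ⊞ (r · u · b) ∙ h₂)
                       (solve (s ∷ x ∷ u ∷ f ∷ b ∷ r ∷ J ∷ rₚ ∷ []) ℚ-ring)

eval-Bsuc-0 : ∀ m → eval (Bsuc (suc m)) 0ℚ ≡ signℚ (suc (suc m)) · (invℕ (suc m) · invFact (suc m))
eval-Bsuc-0 m = begin
  eval (integ₁ (B′ m)) 0ℚ                            ≡⟨ eval-integ₁-0 (B′ m) ⟩
  - moment 0 (B′ m)                                   ≡⟨ cong -_ (moment-B′ m 0) ⟩
  - (moment 0 (Bsuc m) - invℕ (suc (m ℕ.+ 0)) · F)    ≡⟨ cong (λ M → - (M - invℕ (suc (m ℕ.+ 0)) · F)) (moment-Bsuc m 0) ⟩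
  - (moment-B m 0 - invℕ (suc (m ℕ.+ 0)) · F)
    ≡⟨ cong (λ N → - ((s · 1ℚ · invℕ (suc N) · invFact (suc N) + invℕ (suc N) · invℕ (suc N) · b) - invℕ (suc N) · F))
            (ℕ.+-identityʳ m) ⟩
  - ((s · 1ℚ · r · F + r · r · b) - r · F)            ≡⟨ simplify s r b (invFact-suc m) ⟩
  (- s) · (r · F)                                     ∎
  where
  open ≡-Reasoning
  s = signℚ (suc m)
  r = invℕ (suc m)
  F = invFact (suc m)
  b = invFact m
  simplify : ∀ s r b {F} → F ≡ r · b → - ((s · 1ℚ · r · F + r · r · b) - r · F) ≡ (- s) · (r · F)
  simplify s r b refl = solve (s ∷ r ∷ b ∷ []) ℚ-ring

corollary2p7 : (n : ℕ) → 2 ≤ n →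
    eval (deriv (B (suc n))) 0ℚ ≡ signℚ n *ℚ invℕ ((n ∸ 1) * (n ∸ 1) !)
corollary2p7 (suc (suc m)) (s≤s (s≤s _)) = begin
  eval (deriv (integ₁ (B′ (suc m)))) 0ℚ     ≡⟨ cong (λ p → eval p 0ℚ) (deriv-integ₁ (B′ (suc m))) ⟩
  eval (B′ (suc m)) 0ℚ                      ≡⟨ eval-0-⊖-monomial (Bsuc (suc m)) m (invFact (suc (suc m))) ⟩
  eval (Bsuc (suc m)) 0ℚ                    ≡⟨ eval-Bsuc-0 m ⟩
  σ · (invℕ (suc m) · invFact (suc m))      ≡⟨ cong (_·_ σ) (invℕ-*-! m (suc m)) ⟨
  σ *ℚ invℕ (suc m * suc m !)               ∎
  where
  open ≡-Reasoning
  σ = signℚ (suc (suc m))
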